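{- Let $p$ be a prime, $d,b$ positive integers with $p>3d$, $m\ge1$ an integer, and $0\le l\le b$. Let $i_0,\dots,i_{l-1}$ be distinct elements of $\mathbb{Z}/(b)$, let $$A=(\{1,\dots,m-1\}\times\mathbb{Z}/(b))\cup\{(m,i_0),\dots,(m,i_{l-1})\},$$ and let $\tau$ be any permutation of $A$. Then $$\sum_{a\in A}\delta^\tau_<(a)\ \ge\ b\sum_{a=0}^{m-1}(\delta_<-\delta_\in)(a)+l\,(\delta_<-\delta_\in)(m).$$
   Context: For $(i,u)\in\mathbb{Z}\times\mathbb{Z}/(b)$, $\deg(i,u)=i/d$. $\{x\}$ is the fractional part and $\{x\}'=1+x-\lceil x\rceil$. For $a\in A$, $\delta^\tau_<(a)=1$ if $\{\deg(\tau(a))\}'<\{p\deg(a)\}'$, and $0$ otherwise. For integers $a\ge0$: $\delta_<(a)=1$ if $\{a/d\}'<\{pa/d\}'$, else $0$; $\delta_\in(0)=0$, and for $a\ge1$, $\delta_\in(a)=1$ if there is an integer $i>0$ with $i/d<\{a/d\}$ and $\{a/d\}=\{pi/d\}$, else $0$. -}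

module Defs where

open import Data.Nat using (ℕ; zero; suc; _+_; _*_; _∸_; _<_; _<?_; NonZero)
open import Data.Nat.DivMod using (_%_)
open import Data.Nat.Properties using (_≟_)
open import Data.Fin using (Fin; toℕ)
open import Data.Fin.Properties using (any?)
open import Data.Product using (_×_; _,_; ∃; proj₁)
open import Data.Sum using (_⊎_; inj₁; inj₂)
open import Data.Integer as ℤ using (ℤ)
open import Relation.Binary.PropositionalEquality using (_≡_)
open import Relation.Nullary using (Dec; yes; no)
open import Relation.Nullary.Decidable using (_×-dec_)

𝟙 : ∀ {ℓ} {P : Set ℓ} → Dec P → ℕ
𝟙 (yes _) = 1
𝟙 (no _)  = 0

ΣFin : (n : ℕ) → (Fin n → ℕ) → ℕ
ΣFin zero    f = 0
ΣFin (suc n) f = f Fin.zero + ΣFin n (λ k → f (Fin.suc k))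
  where import Data.Fin as Fin

Σℤ : ℕ → (ℕ → ℤ) → ℤ
Σℤ zero    f = ℤ.+ 0
Σℤ (suc n) f = Σℤ n f ℤ.+ f n

-- For an integer x ≥ 0:  d · {x/d}'  (a numerator in {1,…,d}),
-- since {x/d}' = 1 + x/d - ⌈x/d⌉.
fracP : (d : ℕ) → .{{NonZero d}} → ℕ → ℕ
fracP d zero    = d
fracP d (suc k) = suc (k % d)

δ< : (p d : ℕ) → .{{NonZero d}} → ℕ → ℕ
δ< p d a = 𝟙 (fracP d a <? fracP d (p * a))

-- δ_∈ : δ_∈(0) = 0, and for a ≥ 1, δ_∈(a) = 1 iff there is an integer i > 0
-- with i/d < {a/d} (i.e. i < a mod d) and {a/d} = {pi/d}.
δ∈ : (p d : ℕ) → .{{NonZero d}} → ℕ → ℕ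
δ∈ p d zero    = 0
δ∈ p d (suc k) =
  𝟙 (any? {n = suc k % d}
        (λ (i : Fin (suc k % d)) →
           (0 <? toℕ i) ×-dec ((p * toℕ i) % d ≟ suc k % d)))

δdiff : (p d : ℕ) → .{{NonZero d}} → ℕ → ℤ
δdiff p d a = ℤ.+ (δ< p d a) ℤ.- ℤ.+ (δ∈ p d a)

-- Index type for A = ({1,…,m-1} × ℤ/(b)) ∪ {(m,i_0),…,(m,i_{l-1})}:
-- inj₁ (k , u) stands for (k+1 , u), inj₂ j stands for (m , i_j).
AIdx : (m b l : ℕ) → Set
AIdx m b l = (Fin (m ∸ 1) × Fin b) ⊎ Fin l

elemA : (m b l : ℕ) → (Fin l → Fin b) → AIdx m b l → ℕ × Fin b
elemA m b l is (inj₁ (k , u)) = (suc (toℕ k) , u)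
elemA m b l is (inj₂ j)       = (m , is j)

ΣA : (m b l : ℕ) → (AIdx m b l → ℕ) → ℕ
ΣA m b l f = ΣFin (m ∸ 1) (λ k → ΣFin b (λ u → f (inj₁ (k , u))))
           + ΣFin l (λ j → f (inj₂ j))

-- δ^τ_<(a) = 1 iff {deg τ(a)}' < {p deg a}', with deg(i,u) = i/d
δτ< : (p d m b l : ℕ) → .{{NonZero d}} → (is : Fin l → Fin b)
    → (τ : AIdx m b l → AIdx m b l) → AIdx m b l → ℕ
δτ< p d m b l is τ a =
  𝟙 (fracP d (proj₁ (elemA m b l is (τ a)))
       <? fracP d (p * proj₁ (elemA m b l is a)))

-- Write fr x = d·{x/d}' ∈ {1, …, d} and g x = fr (p x), so δ_<(x) = [fr x < g x].
-- The proof compares δ_< and δ_∈ through the threshold indicators [t < fr x] and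
-- [t < g x], for a threshold t chosen depending on m mod d.
--  (1) Permutation step: [t < g a] ≤ δ^τ_<(a) + [t < fr (τ a)] for every a ∈ A;
--      summing over A, and using that τ permutes A,
--      Σ_A [t < g] ≤ Σ_A δ^τ_< + Σ_A [t < fr].
--  (2) Number theory: p is injective modulo d.  From this, partial sums of
--      P t = δ_< + [t < fr] are dominated by those of Q t = δ_∈ + [t < g] over every
--      full period, and for each residue r some t gives domination up to r and
--      r + 1; hence for every m some t dominates up to both m and m + 1.
--  (3) The elements of A have first coordinates 1, …, m-1 (b times each) and m
--      (l times).  Weighting the two dominations of (2) by b - l and l and adding
--      (1), the threshold sums cancel, which is the theorem.

module Submission where

open import Defs
open import Data.Nat using (ℕ; zero; suc; pred; _+_; _*_; _∸_; _≤_; _<_; _≥_; _<?_; z≤n; s≤s; s≤s⁻¹; z<s; NonZero; >-nonZero; >-nonZero⁻¹)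
open import Data.Nat.Properties
open import Data.Nat.Primality using (Prime)
open import Data.Nat.DivMod using (_%_; _/_; m%n<n; m≡m%n+[m/n]*n; [m+kn]%n≡m%n; m<n⇒m%n≡m; n%n≡0; %-remove-+ˡ)
open import Data.Nat.Divisibility using (_∣_; divides; ∣⇒≤; ∣-refl; n∣m*n)
open import Data.Nat.Coprimality using (coprime-divisor; prime⇒coprime)
import Data.Nat.Coprimality as Coprimality
open import Data.Fin as Fin using (Fin; toℕ; _↑ˡ_; _↑ʳ_; combine)
open import Data.Fin.Properties using (+↔⊎; *↔×; any?; toℕ<n; toℕ-fromℕ<)
open import Data.Product using (_×_; _,_; proj₁; ∃)
open import Data.Sum using (_⊎_; inj₁; inj₂)
open import Data.Sum.Function.Propositional using (_⊎-↔_)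
open import Data.Integer as ℤ using (ℤ)
open import Function.Base using (_∘_)
open import Function.Bundles using (_↔_; Inverse)
open import Function.Definitions using (Injective)
open import Function.Properties.Inverse using (↔-refl; ↔-sym; ↔-trans)
open import Relation.Binary.PropositionalEquality
open import Relation.Nullary using (Dec; yes; no; ¬_)
open import Relation.Binary.Definitions using (tri<; tri≈; tri>)
open import Data.Empty using (⊥-elim)
open import Algebra.Properties.CommutativeSemigroup +-commutativeSemigroup using (interchange; x∙yz≈y∙xz)
open import Relation.Nullary.Decidable using (_×-dec_)
open import Data.Nat.Tactic.RingSolver using (solve-∀)
open import Data.Integer.Tactic.RingSolver renaming (solve-∀ to ℤ-solve-∀)
import Data.Integer.Properties as ℤP
open import Algebra.Properties.CommutativeMonoid.Sum +-0-commutativeMonoid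
  using (sum; sum-cong-≗; ∑-distrib-+; sum-permute)

⟦_<_⟧ : ℕ → ℕ → ℕ
⟦ x < y ⟧ = 𝟙 (x <? y)

⟦_≡_⟧ : ℕ → ℕ → ℕ
⟦ x ≡ y ⟧ = 𝟙 (x ≟ y)

𝟙-yes : ∀ {ℓ} {P : Set ℓ} (D : Dec P) → P → 𝟙 D ≡ 1
𝟙-yes (yes _) _ = refl
𝟙-yes (no ¬p) p = ⊥-elim (¬p p)

𝟙-no : ∀ {ℓ} {P : Set ℓ} (D : Dec P) → ¬ P → 𝟙 D ≡ 0
𝟙-no (yes p) ¬p = ⊥-elim (¬p p)
𝟙-no (no _)  _  = refl

𝟙-≤1 : ∀ {ℓ} {P : Set ℓ} (D : Dec P) → 𝟙 D ≤ 1
𝟙-≤1 (yes _) = s≤s z≤n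
𝟙-≤1 (no _)  = z≤n

𝟙-01 : ∀ {ℓ} {P : Set ℓ} (D : Dec P) → 𝟙 D ≡ 0 ⊎ 𝟙 D ≡ 1
𝟙-01 (yes _) = inj₂ refl
𝟙-01 (no _)  = inj₁ refl

Σℕ : ℕ → (ℕ → ℕ) → ℕ
Σℕ zero    u = 0
Σℕ (suc n) u = Σℕ n u + u n

Σℕ-cong : ∀ n {u v : ℕ → ℕ} → (∀ x → x < n → u x ≡ v x) → Σℕ n u ≡ Σℕ n v
Σℕ-cong zero    u≗v = refl
Σℕ-cong (suc n) u≗v = cong₂ _+_ (Σℕ-cong n (λ x x<n → u≗v x (m<n⇒m<1+n x<n))) (u≗v n (n<1+n n))

Σℕ-mono : ∀ n {u v : ℕ → ℕ} → (∀ x → x < n → u x ≤ v x) → Σℕ n u ≤ Σℕ n v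
Σℕ-mono zero    u≤v = z≤n
Σℕ-mono (suc n) u≤v = +-mono-≤ (Σℕ-mono n (λ x x<n → u≤v x (m<n⇒m<1+n x<n))) (u≤v n (n<1+n n))

Σℕ-+ : ∀ n (u v : ℕ → ℕ) → Σℕ n (λ x → u x + v x) ≡ Σℕ n u + Σℕ n v
Σℕ-+ zero    u v = refl
Σℕ-+ (suc n) u v = trans (cong (_+ (u n + v n)) (Σℕ-+ n u v)) (interchange (Σℕ n u) (Σℕ n v) (u n) (v n))

Σℕ-scale : ∀ n c (u : ℕ → ℕ) → Σℕ n (λ x → c * u x) ≡ c * Σℕ n u
Σℕ-scale zero    c u = sym (*-zeroʳ c)
Σℕ-scale (suc n) c u = trans (cong (_+ c * u n) (Σℕ-scale n c u)) (sym (*-distribˡ-+ c (Σℕ n u) (u n)))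

Σℕ-const : ∀ n c → Σℕ n (λ _ → c) ≡ n * c
Σℕ-const zero    c = refl
Σℕ-const (suc n) c = trans (cong (_+ c) (Σℕ-const n c)) (+-comm (n * c) c)

Σℕ-≤-length : ∀ n {u : ℕ → ℕ} → (∀ x → u x ≤ 1) → Σℕ n u ≤ n
Σℕ-≤-length n {u} u≤1 = ≤-trans (Σℕ-mono n (λ x _ → u≤1 x))
                                (≤-reflexive (trans (Σℕ-const n 1) (*-identityʳ n)))

Σℕ-zero : ∀ n {u : ℕ → ℕ} → (∀ x → x < n → u x ≡ 0) → Σℕ n u ≡ 0
Σℕ-zero n u≡0 = trans (Σℕ-cong n u≡0) (trans (Σℕ-const n 0) (*-zeroʳ n))

Σℕ-single : ∀ n {u : ℕ → ℕ} y → y < n → (∀ x → x < n → x ≢ y → u x ≡ 0) → Σℕ n u ≡ u y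
Σℕ-single (suc n) {u} y y<1+n vanish with m<1+n⇒m<n∨m≡n y<1+n
... | inj₁ y<n  = trans (cong₂ _+_ (Σℕ-single n y y<n (λ x x<n → vanish x (m<n⇒m<1+n x<n)))
                                   (vanish n (n<1+n n) (λ n≡y → <⇒≢ y<n (sym n≡y))))
                        (+-identityʳ (u y))
... | inj₂ refl = cong (_+ u y) (Σℕ-zero n (λ x x<y → vanish x (m<n⇒m<1+n x<y) (<⇒≢ x<y)))

Σℕ-shift : ∀ n (u : ℕ → ℕ) → Σℕ (suc n) u ≡ u 0 + Σℕ n (u ∘ suc)
Σℕ-shift zero    u = +-comm 0 (u 0)
Σℕ-shift (suc n) u = trans (cong (_+ u (suc n)) (Σℕ-shift n u)) (+-assoc (u 0) _ _)

Σℕ-split : ∀ a c (u : ℕ → ℕ) → Σℕ (a + c) u ≡ Σℕ a u + Σℕ c (λ x → u (a + x))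
Σℕ-split zero    c u = refl
Σℕ-split (suc a) c u = begin
    Σℕ (suc (a + c)) u                                  ≡⟨ Σℕ-shift (a + c) u ⟩
    u 0 + Σℕ (a + c) (u ∘ suc)                          ≡⟨ cong (u 0 +_) (Σℕ-split a c (u ∘ suc)) ⟩
    u 0 + (Σℕ a (u ∘ suc) + Σℕ c (λ x → u (suc a + x))) ≡⟨ sym (+-assoc (u 0) _ _) ⟩
    u 0 + Σℕ a (u ∘ suc) + Σℕ c (λ x → u (suc a + x))   ≡⟨ cong (_+ Σℕ c (λ x → u (suc a + x))) (sym (Σℕ-shift a u)) ⟩
    Σℕ (suc a) u + Σℕ c (λ x → u (suc a + x))           ∎
  where open ≡-Reasoning

Σℕ-swap : ∀ n k (f : ℕ → ℕ → ℕ) → Σℕ n (λ x → Σℕ k (f x)) ≡ Σℕ k (λ y → Σℕ n (λ x → f x y))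
Σℕ-swap zero    k f = sym (Σℕ-zero k (λ _ _ → refl))
Σℕ-swap (suc n) k f = trans (cong (_+ Σℕ k (f n)) (Σℕ-swap n k f))
                            (sym (Σℕ-+ k (λ y → Σℕ n (λ x → f x y)) (f n)))

-- ⟦ t < · ⟧ is "transitive up to an error term": if t < y then x < y or t < x.
⟦<⟧-triangle : ∀ t x y → ⟦ t < y ⟧ ≤ ⟦ x < y ⟧ + ⟦ t < x ⟧
⟦<⟧-triangle t x y with t <? y | x <? y | t <? x
... | no _    | _       | _       = z≤n
... | yes _   | yes _   | _       = s≤s z≤n
... | yes _   | no _    | yes _   = ≤-refl
... | yes t<y | no x≮y  | no t≮x  = ⊥-elim (x≮y (≤-<-trans (≮⇒≥ t≮x) t<y))

⟦<⟧-step : ∀ j v → ⟦ j < v ⟧ ≡ ⟦ suc j < v ⟧ + ⟦ v ≡ suc j ⟧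
⟦<⟧-step j v with <-cmp (suc j) v
... | tri< 1+j<v _ _ = trans (𝟙-yes (j <? v) (<-trans (n<1+n j) 1+j<v))
    (sym (cong₂ _+_ (𝟙-yes (suc j <? v) 1+j<v) (𝟙-no (v ≟ suc j) (λ e → <-irrefl (sym e) 1+j<v))))
... | tri≈ _ 1+j≡v _ = trans (𝟙-yes (j <? v) (subst (j <_) 1+j≡v (n<1+n j)))
    (sym (cong₂ _+_ (𝟙-no (suc j <? v) (<-irrefl 1+j≡v)) (𝟙-yes (v ≟ suc j) (sym 1+j≡v))))
... | tri> _ 1+j≢v v<1+j = trans (𝟙-no (j <? v) (λ j<v → <⇒≱ j<v (s≤s⁻¹ v<1+j)))
    (sym (cong₂ _+_ (𝟙-no (suc j <? v) (<-asym v<1+j)) (𝟙-no (v ≟ suc j) (1+j≢v ∘ sym))))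

⟦<⟧-antitone : ∀ j v → ⟦ suc j < v ⟧ ≤ ⟦ j < v ⟧
⟦<⟧-antitone j v = subst (⟦ suc j < v ⟧ ≤_) (sym (⟦<⟧-step j v)) (m≤m+n _ _)

⟦<⟧-or-below : ∀ t v → 0 < v → ⟦ t < v ⟧ + Σℕ t (λ c → ⟦ v ≡ suc c ⟧) ≡ 1
⟦<⟧-or-below t v 0<v with t <? v
... | yes t<v = cong suc (Σℕ-zero t (λ c c<t → 𝟙-no (v ≟ suc c) (λ v≡1+c → <-irrefl (sym v≡1+c) (≤-<-trans c<t t<v))))
... | no t≮v = trans
      (Σℕ-single t (pred v) (≤-trans (≤-reflexive (suc-pred v)) (≮⇒≥ t≮v))
         (λ c _ c≢v-1 → 𝟙-no (v ≟ suc c) (λ v≡1+c → c≢v-1 (cong pred (sym v≡1+c)))))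
      (𝟙-yes (v ≟ suc (pred v)) (sym (suc-pred v)))
  where instance _ = >-nonZero 0<v

InjectiveBelow : ℕ → (ℕ → ℕ) → Set
InjectiveBelow N f = ∀ {x y} → x < N → y < N → f x ≡ f y → x ≡ y

-- The number of x < N with f x = v is 1 or 0 according to whether v has a
-- preimage; the preimage may be described by any predicate P equivalent to it.
Σℕ-count : ∀ N (f : ℕ → ℕ) v {P : Fin N → Set} → InjectiveBelow N f →
  (∀ i → P i → f (toℕ i) ≡ v) → (∀ i → f (toℕ i) ≡ v → P i) →
  (D : Dec (∃ P)) → Σℕ N (λ x → ⟦ f x ≡ v ⟧) ≡ 𝟙 D
Σℕ-count N f v f-inj P⇒ ⇒P (yes (i , Pi)) = trans
  (Σℕ-single N (toℕ i) (toℕ<n i) (λ x x<N x≢i → 𝟙-no (f x ≟ v)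
     (λ fx≡v → x≢i (f-inj x<N (toℕ<n i) (trans fx≡v (sym (P⇒ i Pi)))))))
  (𝟙-yes (f (toℕ i) ≟ v) (P⇒ i Pi))
Σℕ-count N f v f-inj P⇒ ⇒P (no ∄P) = Σℕ-zero N (λ x x<N → 𝟙-no (f x ≟ v) (λ fx≡v →
  ∄P (Fin.fromℕ< x<N , ⇒P _ (subst (λ z → f z ≡ v) (sym (toℕ-fromℕ< x<N)) fx≡v))))

Σℕ-count≤1 : ∀ N (f : ℕ → ℕ) v → InjectiveBelow N f → Σℕ N (λ x → ⟦ f x ≡ v ⟧) ≤ 1
Σℕ-count≤1 N f v f-inj = subst (_≤ 1) (sym (Σℕ-count N f v f-inj (λ _ e → e) (λ _ e → e) D)) (𝟙-≤1 D)
  where D = any? (λ (i : Fin N) → f (toℕ i) ≟ v)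

-- An injective function with positive values takes at most t of its N values
-- in {1, …, t}, so at least N - t of them exceed t.
injective-above-threshold : ∀ N t (f : ℕ → ℕ) → InjectiveBelow N f → (∀ x → 0 < f x) →
  N ≤ Σℕ N (λ x → ⟦ t < f x ⟧) + t
injective-above-threshold N t f f-inj f-pos = begin
    N                                                             ≡⟨ sym (trans (Σℕ-const N 1) (*-identityʳ N)) ⟩
    Σℕ N (λ _ → 1)                                                ≡⟨ Σℕ-cong N (λ x _ → sym (⟦<⟧-or-below t (f x) (f-pos x))) ⟩
    Σℕ N (λ x → ⟦ t < f x ⟧ + Σℕ t (λ c → ⟦ f x ≡ suc c ⟧))       ≡⟨ Σℕ-+ N _ _ ⟩
    Σℕ N (λ x → ⟦ t < f x ⟧) + Σℕ N (λ x → Σℕ t (λ c → ⟦ f x ≡ suc c ⟧))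
                                                                  ≡⟨ cong (Σℕ N (λ x → ⟦ t < f x ⟧) +_) (Σℕ-swap N t _) ⟩
    Σℕ N (λ x → ⟦ t < f x ⟧) + Σℕ t (λ c → Σℕ N (λ x → ⟦ f x ≡ suc c ⟧))
                                                                  ≤⟨ +-monoʳ-≤ _ (Σℕ-≤-length t (λ c → Σℕ-count≤1 N f (suc c) f-inj)) ⟩
    Σℕ N (λ x → ⟦ t < f x ⟧) + t                                  ∎
  where open ≤-Reasoning

-- Sums over Fin n: ΣFin agrees with the library's sum, which supplies additivity
-- and invariance under permutations.

ΣFin-cong : ∀ n {f g : Fin n → ℕ} → (∀ i → f i ≡ g i) → ΣFin n f ≡ ΣFin n g
ΣFin-cong zero    f≗g = refl
ΣFin-cong (suc n) f≗g = cong₂ _+_ (f≗g Fin.zero) (ΣFin-cong n (f≗g ∘ Fin.suc))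

ΣFin-sum : ∀ n (f : Fin n → ℕ) → ΣFin n f ≡ sum f
ΣFin-sum zero    f = refl
ΣFin-sum (suc n) f = cong (f Fin.zero +_) (ΣFin-sum n (f ∘ Fin.suc))

ΣFin-toℕ : ∀ n (u : ℕ → ℕ) → ΣFin n (λ i → u (toℕ i)) ≡ Σℕ n u
ΣFin-toℕ zero    u = refl
ΣFin-toℕ (suc n) u = trans (cong (u 0 +_) (ΣFin-toℕ n (u ∘ suc))) (sym (Σℕ-shift n u))

ΣFin-const : ∀ n c → ΣFin n (λ _ → c) ≡ n * c
ΣFin-const n c = trans (ΣFin-toℕ n (λ _ → c)) (Σℕ-const n c)

sum-mono : ∀ {n} {f g : Fin n → ℕ} → (∀ i → f i ≤ g i) → sum f ≤ sum g
sum-mono {zero}  f≤g = z≤n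
sum-mono {suc n} f≤g = +-mono-≤ (f≤g Fin.zero) (sum-mono (f≤g ∘ Fin.suc))

sum-split : ∀ m {n} (f : Fin (m + n) → ℕ) →
  sum f ≡ sum (λ i → f (i ↑ˡ n)) + sum (λ j → f (m ↑ʳ j))
sum-split zero    f = refl
sum-split (suc m) f = trans (cong (f Fin.zero +_) (sum-split m (f ∘ Fin.suc)))
                            (sym (+-assoc (f Fin.zero) _ _))

sum-combine : ∀ m n (f : Fin (m * n) → ℕ) →
  sum f ≡ sum (λ (i : Fin m) → sum (λ (j : Fin n) → f (combine i j)))
sum-combine zero    n f = refl
sum-combine (suc m) n f = trans (sum-split n f) (cong (sum (λ j → f (j ↑ˡ (m * n)) ) +_)
                                  (sum-combine m n (λ k → f (n ↑ʳ k))))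

module _ (m b l : ℕ) where

  enumA : Fin ((m ∸ 1) * b + l) ↔ AIdx m b l
  enumA = ↔-trans +↔⊎ (*↔× ⊎-↔ ↔-refl)

  ΣA-enum : ∀ f → ΣA m b l f ≡ sum (f ∘ Inverse.to enumA)
  ΣA-enum f = sym (begin
      sum (f ∘ to)
    ≡⟨ sum-split ((m ∸ 1) * b) (f ∘ to) ⟩
      sum (λ i → f (to (i ↑ˡ l))) + sum (λ j → f (to ((m ∸ 1) * b ↑ʳ j)))
    ≡⟨ cong (_+ sum (λ j → f (to ((m ∸ 1) * b ↑ʳ j)))) (sum-combine (m ∸ 1) b (λ i → f (to (i ↑ˡ l)))) ⟩
      sum (λ (k : Fin (m ∸ 1)) → sum (λ (u : Fin b) → f (to (from (inj₁ (k , u)))))) + sum (λ (j : Fin l) → f (to (from (inj₂ j))))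
    ≡⟨ cong₂ _+_ (sum-cong-≗ (λ k → sum-cong-≗ (λ u → cong f (strictlyInverseˡ (inj₁ (k , u))))))
                 (sum-cong-≗ (λ j → cong f (strictlyInverseˡ (inj₂ j)))) ⟩
      sum (λ (k : Fin (m ∸ 1)) → sum (λ (u : Fin b) → f (inj₁ (k , u)))) + sum (λ (j : Fin l) → f (inj₂ j))
    ≡⟨ sym (cong₂ _+_ (trans (ΣFin-sum (m ∸ 1) _) (sum-cong-≗ (λ k → ΣFin-sum b (λ u → f (inj₁ (k , u))))))
                      (ΣFin-sum l (f ∘ inj₂))) ⟩
      ΣA m b l f ∎)
    where
    open ≡-Reasoning
    open Inverse enumA

  ΣA-mono : ∀ {f g : AIdx m b l → ℕ} → (∀ a → f a ≤ g a) → ΣA m b l f ≤ ΣA m b l g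
  ΣA-mono {f} {g} f≤g = subst₂ _≤_ (sym (ΣA-enum f)) (sym (ΣA-enum g)) (sum-mono (f≤g ∘ Inverse.to enumA))

  ΣA-+ : ∀ (f g : AIdx m b l → ℕ) → ΣA m b l (λ a → f a + g a) ≡ ΣA m b l f + ΣA m b l g
  ΣA-+ f g = begin
      ΣA m b l (λ a → f a + g a)                    ≡⟨ ΣA-enum (λ a → f a + g a) ⟩
      sum (λ i → f (to i) + g (to i))               ≡⟨ ∑-distrib-+ (f ∘ to) (g ∘ to) ⟩
      sum (f ∘ to) + sum (g ∘ to)                   ≡⟨ sym (cong₂ _+_ (ΣA-enum f) (ΣA-enum g)) ⟩
      ΣA m b l f + ΣA m b l g                       ∎
    where
    open ≡-Reasoning
    open Inverse enumA

  ΣA-perm : (τ : AIdx m b l ↔ AIdx m b l) (h : AIdx m b l → ℕ) →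
    ΣA m b l (h ∘ Inverse.to τ) ≡ ΣA m b l h
  ΣA-perm τ h = begin
      ΣA m b l (h ∘ Inverse.to τ)                   ≡⟨ ΣA-enum (h ∘ Inverse.to τ) ⟩
      sum (h ∘ Inverse.to τ ∘ to)                   ≡⟨ sum-cong-≗ (λ i → cong h (sym (strictlyInverseˡ (Inverse.to τ (to i))))) ⟩
      sum (h ∘ to ∘ Inverse.to π)                   ≡⟨ sym (sum-permute (h ∘ to) π) ⟩
      sum (h ∘ to)                                  ≡⟨ sym (ΣA-enum h) ⟩
      ΣA m b l h                                    ∎
    where
    open ≡-Reasoning
    open Inverse enumA
    π : Fin ((m ∸ 1) * b + l) ↔ Fin ((m ∸ 1) * b + l)
    π = ↔-trans enumA (↔-trans τ (↔-sym enumA))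

  ΣA-first : ∀ (is : Fin l → Fin b) (u : ℕ → ℕ) →
    ΣA m b l (λ a → u (proj₁ (elemA m b l is a))) ≡ b * Σℕ (m ∸ 1) (u ∘ suc) + l * u m
  ΣA-first is u = cong₂ _+_
    (begin
      ΣFin (m ∸ 1) (λ k → ΣFin b (λ _ → u (suc (toℕ k))))  ≡⟨ ΣFin-cong (m ∸ 1) (λ k → ΣFin-const b _) ⟩
      ΣFin (m ∸ 1) (λ k → b * u (suc (toℕ k)))             ≡⟨ ΣFin-toℕ (m ∸ 1) (λ x → b * u (suc x)) ⟩
      Σℕ (m ∸ 1) (λ x → b * u (suc x))                      ≡⟨ Σℕ-scale (m ∸ 1) b (u ∘ suc) ⟩
      b * Σℕ (m ∸ 1) (u ∘ suc)                              ∎)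
    (ΣFin-const l (u m))
    where open ≡-Reasoning

%-≡⇒∣∸ : ∀ {m n d} .{{_ : NonZero d}} → m % d ≡ n % d → d ∣ n ∸ m
%-≡⇒∣∸ {m} {n} {d} m≡n = divides (n / d ∸ m / d) (begin
    n ∸ m                                     ≡⟨ cong₂ _∸_ (m≡m%n+[m/n]*n n d) (m≡m%n+[m/n]*n m d) ⟩
    (n % d + n / d * d) ∸ (m % d + m / d * d)  ≡⟨ cong (λ r → (n % d + n / d * d) ∸ (r + m / d * d)) m≡n ⟩
    (n % d + n / d * d) ∸ (n % d + m / d * d)  ≡⟨ [m+n]∸[m+o]≡n∸o (n % d) _ _ ⟩
    n / d * d ∸ m / d * d                      ≡⟨ sym (*-distribʳ-∸ d (n / d) (m / d)) ⟩
    (n / d ∸ m / d) * d                        ∎)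
  where open ≡-Reasoning

prime⇒distinct-residues : ∀ {p d x y} .{{_ : NonZero d}} → Prime p → d < p →
  x < y → y < d → (p * x) % d ≢ (p * y) % d
prime⇒distinct-residues {p} {d} {x} {y} p-prime d<p x<y y<d px≡py =
  <⇒≱ y<d (≤-trans (∣⇒≤ d∣y-x) (m∸n≤m y x))
  where
  instance _ = >-nonZero (m<n⇒0<n∸m x<y)
  d∣y-x : d ∣ y ∸ x
  d∣y-x = coprime-divisor (Coprimality.sym (prime⇒coprime p-prime d<p))
                          (subst (d ∣_) (sym (*-distribˡ-∸ p y x)) (%-≡⇒∣∸ px≡py))

prime⇒mul-injective : ∀ {p d} .{{_ : NonZero d}} → Prime p → d < p → InjectiveBelow d (λ x → (p * x) % d)
prime⇒mul-injective p-prime d<p {x} {y} x<d y<d px≡py with <-cmp x y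
... | tri< x<y _ _ = ⊥-elim (prime⇒distinct-residues p-prime d<p x<y y<d px≡py)
... | tri≈ _ x≡y _ = x≡y
... | tri> _ _ y<x = ⊥-elim (prime⇒distinct-residues p-prime d<p y<x x<d (sym px≡py))

weighted-sum : ∀ {b l x y u v} → l ≤ b → x ≤ y → x + u ≤ y + v → b * x + l * u ≤ b * y + l * v
weighted-sum {b} {l} {x} {y} {u} {v} l≤b x≤y xu≤yv =
  subst (λ b → b * x + l * u ≤ b * y + l * v) (m+[n∸m]≡n l≤b) (begin
    (l + c) * x + l * u     ≡⟨ regroup l c x u ⟩
    c * x + l * (x + u)     ≤⟨ +-mono-≤ (*-monoʳ-≤ c x≤y) (*-monoʳ-≤ l xu≤yv) ⟩
    c * y + l * (y + v)     ≡⟨ sym (regroup l c y v) ⟩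
    (l + c) * y + l * v     ∎)
  where
  open ≤-Reasoning
  c = b ∸ l
  regroup : ∀ l c x u → (l + c) * x + l * u ≡ c * x + l * (x + u)
  regroup = solve-∀

-- The inequalities of steps (1) and (2) combine to the theorem; the threshold
-- sums F and G cancel.
combine-bounds : ∀ b l {A₁ A₂ B₁ B₂ F₁ F₂ G₁ G₂} L → l ≤ b →
  A₁ + F₁ ≤ B₁ + G₁ →
  A₁ + F₁ + (A₂ + F₂) ≤ B₁ + G₁ + (B₂ + G₂) →
  b * G₁ + l * G₂ ≤ L + (b * F₁ + l * F₂) →
  b * A₁ + l * A₂ ≤ L + (b * B₁ + l * B₂)
combine-bounds b l {A₁} {A₂} {B₁} {B₂} {F₁} {F₂} {G₁} {G₂} L l≤b dom₁ dom₂ perm =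
  +-cancelʳ-≤ (b * F₁ + l * F₂) _ _ (begin
    b * A₁ + l * A₂ + (b * F₁ + l * F₂)          ≡⟨ regroup b l A₁ A₂ F₁ F₂ ⟩
    b * (A₁ + F₁) + l * (A₂ + F₂)                ≤⟨ weighted-sum l≤b dom₁ dom₂ ⟩
    b * (B₁ + G₁) + l * (B₂ + G₂)                ≡⟨ sym (regroup b l B₁ B₂ G₁ G₂) ⟩
    b * B₁ + l * B₂ + (b * G₁ + l * G₂)          ≤⟨ +-monoʳ-≤ (b * B₁ + l * B₂) perm ⟩
    b * B₁ + l * B₂ + (L + (b * F₁ + l * F₂))    ≡⟨ sym (+-assoc (b * B₁ + l * B₂) L _) ⟩
    b * B₁ + l * B₂ + L + (b * F₁ + l * F₂)      ≡⟨ cong (_+ (b * F₁ + l * F₂)) (+-comm (b * B₁ + l * B₂) L) ⟩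
    L + (b * B₁ + l * B₂) + (b * F₁ + l * F₂)    ∎)
  where
  open ≤-Reasoning
  regroup : ∀ b l A₁ A₂ F₁ F₂ → b * A₁ + l * A₂ + (b * F₁ + l * F₂) ≡ b * (A₁ + F₁) + l * (A₂ + F₂)
  regroup = solve-∀

module Residues (p d : ℕ) .{{_ : NonZero d}} (mul-inj : InjectiveBelow d (λ x → (p * x) % d)) where

  fr : ℕ → ℕ
  fr = fracP d

  g : ℕ → ℕ
  g x = fr (p * x)

  0<d : 0 < d
  0<d = >-nonZero⁻¹ d

  fr-pos : ∀ z → 0 < fr z
  fr-pos zero    = 0<d
  fr-pos (suc k) = z<s

  fr-≤ : ∀ z → fr z ≤ d
  fr-≤ zero    = ≤-refl
  fr-≤ (suc k) = m%n<n k d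

  fr-mod : ∀ z → fr z % d ≡ z % d
  fr-mod zero    = trans (n%n≡0 d) (sym (m<n⇒m%n≡m 0<d))
  fr-mod (suc k) = sym (trans (cong (λ z → suc z % d) (m≡m%n+[m/n]*n k d))
                              ([m+kn]%n≡m%n (suc (k % d)) (k / d) d))

  residue-determines : ∀ {a c} → 0 < a → a ≤ d → 0 < c → c ≤ d → a % d ≡ c % d → a ≡ c
  residue-determines 0<a a≤d 0<c c≤d a≡c with m≤n⇒m<n∨m≡n a≤d | m≤n⇒m<n∨m≡n c≤d
  ... | inj₁ a<d  | inj₁ c<d  = trans (sym (m<n⇒m%n≡m a<d)) (trans a≡c (m<n⇒m%n≡m c<d))
  ... | inj₁ a<d  | inj₂ refl = ⊥-elim (<⇒≢ 0<a (sym (trans (sym (m<n⇒m%n≡m a<d)) (trans a≡c (n%n≡0 d)))))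
  ... | inj₂ refl | inj₁ c<d  = ⊥-elim (<⇒≢ 0<c (sym (trans (sym (m<n⇒m%n≡m c<d)) (trans (sym a≡c) (n%n≡0 d)))))
  ... | inj₂ refl | inj₂ refl = refl

  fr-cong : ∀ {z z'} → z % d ≡ z' % d → fr z ≡ fr z'
  fr-cong {z} {z'} z≡z' = residue-determines (fr-pos z) (fr-≤ z) (fr-pos z') (fr-≤ z')
                            (trans (fr-mod z) (trans z≡z' (sym (fr-mod z'))))

  fr-small : ∀ {x} → 0 < x → x < d → fr x ≡ x
  fr-small {suc k} _ 1+k<d = cong suc (m<n⇒m%n≡m (<-trans (n<1+n k) 1+k<d))

  fr-periodic : ∀ x → fr (d + x) ≡ fr x
  fr-periodic x = fr-cong (%-remove-+ˡ x ∣-refl)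

  g-periodic : ∀ x → g (d + x) ≡ g x
  g-periodic x = fr-cong (trans (cong (_% d) (*-distribˡ-+ p d x)) (%-remove-+ˡ (p * x) (n∣m*n p)))

  g-zero : g 0 ≡ d
  g-zero = cong fr (*-zeroʳ p)

  g-injective : InjectiveBelow d g
  g-injective {x} {y} x<d y<d gx≡gy =
    mul-inj x<d y<d (trans (sym (fr-mod (p * x))) (trans (cong (_% d) gx≡gy) (fr-mod (p * y))))

  g≡⇒mod : ∀ {x r} → r < d → g x ≡ r → (p * x) % d ≡ r
  g≡⇒mod {x} r<d gx≡r = trans (sym (fr-mod (p * x))) (trans (cong (_% d) gx≡r) (m<n⇒m%n≡m r<d))

  mod⇒g≡ : ∀ {x r} → 0 < r → r < d → (p * x) % d ≡ r → g x ≡ r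
  mod⇒g≡ 0<r r<d px≡r = trans (fr-cong (trans px≡r (sym (m<n⇒m%n≡m r<d)))) (fr-small 0<r r<d)

  Δ∈ : ℕ → ℕ
  Δ∈ r = 𝟙 (any? (λ (i : Fin r) → (0 <? toℕ i) ×-dec ((p * toℕ i) % d ≟ r)))

  δ∈-residue : ∀ x → δ∈ p d x ≡ Δ∈ (x % d)
  δ∈-residue zero    = sym (cong Δ∈ (m<n⇒m%n≡m 0<d))
  δ∈-residue (suc k) = refl

  δ∈-small : ∀ {r} → r < d → δ∈ p d r ≡ Δ∈ r
  δ∈-small {r} r<d = trans (δ∈-residue r) (cong Δ∈ (m<n⇒m%n≡m r<d))

  δ∈-periodic : ∀ x → δ∈ p d (d + x) ≡ δ∈ p d x
  δ∈-periodic x = trans (δ∈-residue (d + x)) (trans (cong Δ∈ (%-remove-+ˡ x ∣-refl)) (sym (δ∈-residue x)))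

  δ<-zero : δ< p d 0 ≡ 0
  δ<-zero = trans (cong (λ v → ⟦ d < v ⟧) g-zero) (𝟙-no (d <? d) (<-irrefl refl))

  count-preimages : ∀ {r} → 0 < r → r < d → Σℕ r (λ x → ⟦ g x ≡ r ⟧) ≡ Δ∈ r
  count-preimages {r} 0<r r<d = Σℕ-count r g r (λ x<r y<r → g-injective (<-trans x<r r<d) (<-trans y<r r<d))
    (λ i (_ , pi≡r) → mod⇒g≡ 0<r r<d pi≡r)
    (λ i gi≡r → preimage-pos (toℕ i) gi≡r , g≡⇒mod r<d gi≡r)
    _
    where
    preimage-pos : ∀ x → g x ≡ r → 0 < x
    preimage-pos zero    g0≡r = ⊥-elim (<⇒≢ r<d (sym (trans (sym g-zero) g0≡r)))
    preimage-pos (suc x) _    = z<s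

  -- Raising the threshold from j to j+1 loses exactly the x ≤ j with g x = j+1,
  -- which are counted by δ_∈(j+1).
  threshold-identity : ∀ j → j < d →
    Σℕ (suc j) (δ< p d) + 1 ≡ Σℕ (suc j) (δ∈ p d) + Σℕ (suc j) (λ x → ⟦ j < g x ⟧)
  threshold-identity zero _ = trans (cong (_+ 1) δ<-zero)
    (sym (trans (cong (λ v → ⟦ 0 < v ⟧) g-zero) (𝟙-yes (0 <? d) 0<d)))
  threshold-identity (suc j) 1+j<d = begin
      Σ (δ< p d) + δ< p d (suc j) + 1
    ≡⟨ rearrange₁ (Σ (δ< p d)) _ ⟩
      (Σ (δ< p d) + 1) + δ< p d (suc j)
    ≡⟨ cong₂ _+_ (threshold-identity j (<-trans (n<1+n j) 1+j<d)) δ<-at ⟩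
      Σ (δ∈ p d) + Σ (λ x → ⟦ j < g x ⟧) + ⟦ suc j < g (suc j) ⟧
    ≡⟨ cong (λ s → Σ (δ∈ p d) + s + ⟦ suc j < g (suc j) ⟧)
            (trans (Σℕ-cong (suc j) (λ x _ → ⟦<⟧-step j (g x))) (Σℕ-+ (suc j) _ _)) ⟩
      Σ (δ∈ p d) + (Σ (λ x → ⟦ suc j < g x ⟧) + Σ (λ x → ⟦ g x ≡ suc j ⟧)) + ⟦ suc j < g (suc j) ⟧
    ≡⟨ cong (λ c → Σ (δ∈ p d) + (Σ (λ x → ⟦ suc j < g x ⟧) + c) + ⟦ suc j < g (suc j) ⟧)
            (trans (count-preimages z<s 1+j<d) (sym (δ∈-small 1+j<d))) ⟩
      Σ (δ∈ p d) + (Σ (λ x → ⟦ suc j < g x ⟧) + δ∈ p d (suc j)) + ⟦ suc j < g (suc j) ⟧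
    ≡⟨ rearrange₂ (Σ (δ∈ p d)) _ _ _ ⟩
      Σ (δ∈ p d) + δ∈ p d (suc j) + (Σ (λ x → ⟦ suc j < g x ⟧) + ⟦ suc j < g (suc j) ⟧)
    ∎
    where
    open ≡-Reasoning
    Σ = Σℕ (suc j)
    δ<-at : δ< p d (suc j) ≡ ⟦ suc j < g (suc j) ⟧
    δ<-at = cong (λ v → ⟦ v < g (suc j) ⟧) (fr-small z<s 1+j<d)
    rearrange₁ : ∀ a b → a + b + 1 ≡ a + 1 + b
    rearrange₁ = solve-∀
    rearrange₂ : ∀ a b c e → a + (b + c) + e ≡ a + c + (b + e)
    rearrange₂ = solve-∀

  -- Among x ≤ t < d only x = 0 has fr x = d above the threshold t.
  fr-threshold-prefix : ∀ t → t < d → Σℕ (suc t) (λ x → ⟦ t < fr x ⟧) ≡ 1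
  fr-threshold-prefix t t<d = trans
    (Σℕ-single (suc t) 0 z<s (λ x x≤t x≢0 → 𝟙-no (t <? fr x)
       (λ t<fr → <⇒≱ t<fr (≤-trans (≤-reflexive (fr-small (n≢0⇒n>0 x≢0) (≤-<-trans (s≤s⁻¹ x≤t) t<d))) (s≤s⁻¹ x≤t)))))
    (𝟙-yes (t <? d) t<d)

  -- Over one period the threshold count for fr is at most d - t …
  fr-threshold-period : ∀ t → t < d → Σℕ d (λ x → ⟦ t < fr x ⟧) + t ≤ d
  fr-threshold-period t t<d = begin
      Σℕ d u + t                                    ≡⟨ cong (λ n → Σℕ n u + t) (sym (m+[n∸m]≡n t<d)) ⟩
      Σℕ (suc t + k) u + t                          ≡⟨ cong (_+ t) (Σℕ-split (suc t) k u) ⟩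
      Σℕ (suc t) u + Σℕ k (λ x → u (suc t + x)) + t  ≡⟨ cong (λ s → s + Σℕ k (λ x → u (suc t + x)) + t) (fr-threshold-prefix t t<d) ⟩
      suc (Σℕ k (λ x → u (suc t + x))) + t          ≤⟨ +-monoˡ-≤ t (s≤s (Σℕ-≤-length k (λ x → 𝟙-≤1 (t <? fr (suc t + x))))) ⟩
      suc k + t                                     ≡⟨ sym (+-suc k t) ⟩
      k + suc t                                     ≡⟨ m∸n+n≡m t<d ⟩
      d                                             ∎
    where
    open ≤-Reasoning
    u = λ x → ⟦ t < fr x ⟧
    k = d ∸ suc t

  -- … while for the injective g it is at least d - t.
  threshold-period : ∀ t → Σℕ d (λ x → ⟦ t < fr x ⟧) ≤ Σℕ d (λ x → ⟦ t < g x ⟧)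
  threshold-period t with t <? d
  ... | yes t<d = +-cancelʳ-≤ t _ _ (≤-trans (fr-threshold-period t t<d)
                    (injective-above-threshold d t g g-injective (fr-pos ∘ (p *_))))
  ... | no t≮d  = ≤-trans (≤-reflexive (Σℕ-zero d (λ x _ → 𝟙-no (t <? fr x)
                    (λ t<fr → t≮d (<-≤-trans t<fr (fr-≤ x)))))) z≤n

  δ-period : Σℕ d (δ< p d) ≡ Σℕ d (δ∈ p d)
  δ-period = +-cancelʳ-≡ 1 _ _ (subst (λ n → Σℕ n (δ< p d) + 1 ≡ Σℕ n (δ∈ p d) + 1) (suc-pred d)
    (trans (threshold-identity (pred d) pred<d) (cong (Σℕ (suc (pred d)) (δ∈ p d) +_) top-count)))
    where
    pred<d : pred d < d
    pred<d = subst (pred d <_) (suc-pred d) (n<1+n (pred d))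
    -- only x = 0 has g x = d
    top-count : Σℕ (suc (pred d)) (λ x → ⟦ pred d < g x ⟧) ≡ 1
    top-count = trans
      (Σℕ-single (suc (pred d)) 0 z<s (λ x x<d x≢0 → 𝟙-no (pred d <? g x) (λ pred<gx →
         x≢0 (g-injective (subst (x <_) (suc-pred d) x<d) 0<d
               (trans (≤-antisym (fr-≤ (p * x)) (subst (_≤ g x) (suc-pred d) pred<gx)) (sym g-zero))))))
      (trans (cong (λ v → ⟦ pred d < v ⟧) g-zero) (𝟙-yes (pred d <? d) pred<d))

  P Q : ℕ → ℕ → ℕ
  P t x = δ< p d x + ⟦ t < fr x ⟧
  Q t x = δ∈ p d x + ⟦ t < g x ⟧

  Dominated : ℕ → ℕ → Set
  Dominated t N = Σℕ N (P t) ≤ Σℕ N (Q t)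

  P-periodic : ∀ t x → P t (d + x) ≡ P t x
  P-periodic t x = cong₂ (λ a c → ⟦ a < c ⟧ + ⟦ t < a ⟧) (fr-periodic x) (g-periodic x)

  Q-periodic : ∀ t x → Q t (d + x) ≡ Q t x
  Q-periodic t x = cong₂ _+_ (δ∈-periodic x) (cong (λ v → ⟦ t < v ⟧) (g-periodic x))

  P-small : ∀ t {r} → 0 < r → r < d → P t r ≡ ⟦ r < g r ⟧ + ⟦ t < r ⟧
  P-small t 0<r r<d = cong (λ a → ⟦ a < g _ ⟧ + ⟦ t < a ⟧) (fr-small 0<r r<d)

  Q-small : ∀ t {r} → r < d → Q t r ≡ Δ∈ r + ⟦ t < g r ⟧
  Q-small t r<d = cong (_+ ⟦ t < g _ ⟧) (δ∈-small r<d)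

  P≡Q-at-zero : ∀ t → P t 0 ≡ Q t 0
  P≡Q-at-zero t = cong₂ _+_ δ<-zero (cong (λ v → ⟦ t < v ⟧) (sym g-zero))

  balanced : ∀ j → j < d → Σℕ (suc j) (P j) ≡ Σℕ (suc j) (Q j)
  balanced j j<d = begin
      Σℕ (suc j) (P j)                                            ≡⟨ Σℕ-+ (suc j) (δ< p d) _ ⟩
      Σℕ (suc j) (δ< p d) + Σℕ (suc j) (λ x → ⟦ j < fr x ⟧)        ≡⟨ cong (Σℕ (suc j) (δ< p d) +_) (fr-threshold-prefix j j<d) ⟩
      Σℕ (suc j) (δ< p d) + 1                                     ≡⟨ threshold-identity j j<d ⟩
      Σℕ (suc j) (δ∈ p d) + Σℕ (suc j) (λ x → ⟦ j < g x ⟧)         ≡⟨ sym (Σℕ-+ (suc j) (δ∈ p d) _) ⟩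
      Σℕ (suc j) (Q j)                                            ∎
    where open ≡-Reasoning

  dominated-period : ∀ t → Dominated t d
  dominated-period t = begin
      Σℕ d (P t)                                          ≡⟨ Σℕ-+ d (δ< p d) _ ⟩
      Σℕ d (δ< p d) + Σℕ d (λ x → ⟦ t < fr x ⟧)            ≤⟨ +-mono-≤ (≤-reflexive δ-period) (threshold-period t) ⟩
      Σℕ d (δ∈ p d) + Σℕ d (λ x → ⟦ t < g x ⟧)             ≡⟨ sym (Σℕ-+ d (δ∈ p d) _) ⟩
      Σℕ d (Q t)                                          ∎
    where open ≤-Reasoning

  dominated-shift : ∀ t N → Dominated t N → Dominated t (d + N)
  dominated-shift t N dom = begin
      Σℕ (d + N) (P t)                                    ≡⟨ Σℕ-split d N (P t) ⟩
      Σℕ d (P t) + Σℕ N (λ x → P t (d + x))               ≡⟨ cong (Σℕ d (P t) +_) (Σℕ-cong N (λ x _ → P-periodic t x)) ⟩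
      Σℕ d (P t) + Σℕ N (P t)                             ≤⟨ +-mono-≤ (dominated-period t) dom ⟩
      Σℕ d (Q t) + Σℕ N (Q t)                             ≡⟨ sym (cong (Σℕ d (Q t) +_) (Σℕ-cong N (λ x _ → Q-periodic t x))) ⟩
      Σℕ d (Q t) + Σℕ N (λ x → Q t (d + x))               ≡⟨ sym (Σℕ-split d N (Q t)) ⟩
      Σℕ (d + N) (Q t)                                    ∎
    where open ≤-Reasoning

  dominated-periodic : ∀ t q r → Dominated t r → Dominated t (q * d + r)
  dominated-periodic t zero    r dom = dom
  dominated-periodic t (suc q) r dom = subst (Dominated t) (sym (+-assoc d (q * d) r))
                                         (dominated-shift t (q * d + r) (dominated-periodic t q r dom))

  Δ∈-01 : ∀ r → Δ∈ r ≡ 0 ⊎ Δ∈ r ≡ 1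
  Δ∈-01 r = 𝟙-01 _

  -- For each residue r < d a single threshold dominates both N = r and N = r+1:
  -- t = 0 for r = 0; for r = j+1, t = j if δ_∈(r) = 1 and t = r if δ_∈(r) = 0.
  dominated-locally : ∀ r → r < d → ∃ λ t → Dominated t r × Dominated t (suc r)
  dominated-locally zero    _     = 0 , z≤n , ≤-reflexive (cong (0 +_) (P≡Q-at-zero 0))
  dominated-locally (suc j) 1+j<d with Δ∈-01 (suc j)
  ... | inj₂ Δ≡1 = j , ≤-reflexive (balanced j j<d) , +-mono-≤ (≤-reflexive (balanced j j<d)) last-term
    where
    j<d : j < d
    j<d = <-trans (n<1+n j) 1+j<d
    last-term : P j (suc j) ≤ Q j (suc j)
    last-term = begin
        P j (suc j)                              ≡⟨ P-small j z<s 1+j<d ⟩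
        ⟦ suc j < g (suc j) ⟧ + ⟦ j < suc j ⟧    ≡⟨ cong (⟦ suc j < g (suc j) ⟧ +_) (𝟙-yes (j <? suc j) (n<1+n j)) ⟩
        ⟦ suc j < g (suc j) ⟧ + 1                ≤⟨ +-monoˡ-≤ 1 (⟦<⟧-antitone j (g (suc j))) ⟩
        ⟦ j < g (suc j) ⟧ + 1                    ≡⟨ +-comm _ 1 ⟩
        1 + ⟦ j < g (suc j) ⟧                    ≡⟨ cong (_+ ⟦ j < g (suc j) ⟧) (sym Δ≡1) ⟩
        Δ∈ (suc j) + ⟦ j < g (suc j) ⟧           ≡⟨ sym (Q-small j 1+j<d) ⟩
        Q j (suc j)                              ∎
      where open ≤-Reasoning
  ... | inj₁ Δ≡0 = suc j , ≤-reflexive without-last , ≤-reflexive (balanced (suc j) 1+j<d)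
    where
    last-term : P (suc j) (suc j) ≡ Q (suc j) (suc j)
    last-term = begin
        P (suc j) (suc j)                           ≡⟨ P-small (suc j) z<s 1+j<d ⟩
        ⟦ suc j < g (suc j) ⟧ + ⟦ suc j < suc j ⟧   ≡⟨ cong (⟦ suc j < g (suc j) ⟧ +_) (𝟙-no (suc j <? suc j) (<-irrefl refl)) ⟩
        ⟦ suc j < g (suc j) ⟧ + 0                   ≡⟨ +-comm _ 0 ⟩
        0 + ⟦ suc j < g (suc j) ⟧                   ≡⟨ cong (_+ ⟦ suc j < g (suc j) ⟧) (sym Δ≡0) ⟩
        Δ∈ (suc j) + ⟦ suc j < g (suc j) ⟧          ≡⟨ sym (Q-small (suc j) 1+j<d) ⟩
        Q (suc j) (suc j)                           ∎
      where open ≡-Reasoning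
    without-last : Σℕ (suc j) (P (suc j)) ≡ Σℕ (suc j) (Q (suc j))
    without-last = +-cancelʳ-≡ (P (suc j) (suc j)) _ _
      (trans (balanced (suc j) 1+j<d) (cong (Σℕ (suc j) (Q (suc j)) +_) (sym last-term)))

  dominated-everywhere : ∀ m → ∃ λ t → Dominated t m × Dominated t (suc m)
  dominated-everywhere m with dominated-locally (m % d) (m%n<n m d)
  ... | t , dom-r , dom-r+1 = t , subst (Dominated t) (sym m≡) (dominated-periodic t (m / d) (m % d) dom-r)
                                , subst (Dominated t) (sym 1+m≡) (dominated-periodic t (m / d) (suc (m % d)) dom-r+1)
    where
    m≡ : m ≡ m / d * d + m % d
    m≡ = trans (m≡m%n+[m/n]*n m d) (+-comm (m % d) _)
    1+m≡ : suc m ≡ m / d * d + suc (m % d)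
    1+m≡ = trans (cong suc m≡) (sym (+-suc (m / d * d) (m % d)))

  -- Pointwise ⟦t < g a⟧ ≤ δ^τ_<(a) + ⟦t < fr(τ a)⟧,
  -- and summing ⟦t < fr(τ a)⟧ over A is the same as summing ⟦t < fr a⟧.
  -- The missing b·(x = 0) term is added on both sides, where g 0 = fr 0 = d.
  permutation-bound : ∀ t n b l (is : Fin l → Fin b) (τ : AIdx (suc n) b l ↔ AIdx (suc n) b l) →
    b * Σℕ (suc n) (λ x → ⟦ t < g x ⟧) + l * ⟦ t < g (suc n) ⟧
      ≤ ΣA (suc n) b l (δτ< p d (suc n) b l is (Inverse.to τ))
        + (b * Σℕ (suc n) (λ x → ⟦ t < fr x ⟧) + l * ⟦ t < fr (suc n) ⟧)
  permutation-bound t n b l is τ = begin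
      b * Σℕ (suc n) G + l * G (suc n)       ≡⟨ sym (with-zero G) ⟩
      b * G 0 + ΣA′ (G ∘ first)              ≤⟨ +-monoʳ-≤ (b * G 0) sum-over-A ⟩
      b * G 0 + (L + ΣA′ (F ∘ first))        ≡⟨ x∙yz≈y∙xz (b * G 0) L _ ⟩
      L + (b * G 0 + ΣA′ (F ∘ first))        ≡⟨ cong (λ v → L + (b * ⟦ t < v ⟧ + ΣA′ (F ∘ first))) g-zero ⟩
      L + (b * F 0 + ΣA′ (F ∘ first))        ≡⟨ cong (L +_) (with-zero F) ⟩
      L + (b * Σℕ (suc n) F + l * F (suc n)) ∎
    where
    open ≤-Reasoning
    ΣA′ = ΣA (suc n) b l
    first : AIdx (suc n) b l → ℕ
    first a = proj₁ (elemA (suc n) b l is a)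
    G F : ℕ → ℕ
    G x = ⟦ t < g x ⟧
    F x = ⟦ t < fr x ⟧
    L = ΣA′ (δτ< p d (suc n) b l is (Inverse.to τ))
    with-zero : ∀ u → b * u 0 + ΣA′ (u ∘ first) ≡ b * Σℕ (suc n) u + l * u (suc n)
    with-zero u = begin-equality
        b * u 0 + ΣA′ (u ∘ first)                  ≡⟨ cong (b * u 0 +_) (ΣA-first (suc n) b l is u) ⟩
        b * u 0 + (b * Σℕ n (u ∘ suc) + l * u (suc n)) ≡⟨ sym (+-assoc (b * u 0) _ _) ⟩
        b * u 0 + b * Σℕ n (u ∘ suc) + l * u (suc n)   ≡⟨ cong (_+ l * u (suc n)) (sym (*-distribˡ-+ b (u 0) _)) ⟩
        b * (u 0 + Σℕ n (u ∘ suc)) + l * u (suc n)     ≡⟨ cong (λ s → b * s + l * u (suc n)) (sym (Σℕ-shift n u)) ⟩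
        b * Σℕ (suc n) u + l * u (suc n)               ∎
    sum-over-A : ΣA′ (G ∘ first) ≤ L + ΣA′ (F ∘ first)
    sum-over-A = begin
        ΣA′ (G ∘ first)                                           ≤⟨ ΣA-mono (suc n) b l (λ a → ⟦<⟧-triangle t (fr (first (Inverse.to τ a))) (g (first a))) ⟩
        ΣA′ (λ a → δτ< p d (suc n) b l is (Inverse.to τ) a + F (first (Inverse.to τ a)))
                                                                  ≡⟨ ΣA-+ (suc n) b l (δτ< p d (suc n) b l is (Inverse.to τ)) (F ∘ first ∘ Inverse.to τ) ⟩
        L + ΣA′ (F ∘ first ∘ Inverse.to τ)                        ≡⟨ cong (L +_) (ΣA-perm (suc n) b l τ (F ∘ first)) ⟩
        L + ΣA′ (F ∘ first)                                       ∎

  key-inequality : ∀ n b l (is : Fin l → Fin b) (τ : AIdx (suc n) b l ↔ AIdx (suc n) b l) → l ≤ b →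
    b * Σℕ (suc n) (δ< p d) + l * δ< p d (suc n)
      ≤ ΣA (suc n) b l (δτ< p d (suc n) b l is (Inverse.to τ))
        + (b * Σℕ (suc n) (δ∈ p d) + l * δ∈ p d (suc n))
  key-inequality n b l is τ l≤b with dominated-everywhere (suc n)
  ... | t , dom₁ , dom₂ = combine-bounds b l (ΣA (suc n) b l (δτ< p d (suc n) b l is (Inverse.to τ))) l≤b (subst₂ _≤_ P-split Q-split dom₁)
    (subst₂ _≤_ (cong (_+ P t (suc n)) P-split) (cong (_+ Q t (suc n)) Q-split) dom₂)
    (permutation-bound t n b l is τ)
    where
    P-split = Σℕ-+ (suc n) (δ< p d) (λ x → ⟦ t < fr x ⟧)
    Q-split = Σℕ-+ (suc n) (δ∈ p d) (λ x → ⟦ t < g x ⟧)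

Σℤ-δdiff : ∀ p d .{{_ : NonZero d}} N → Σℤ N (δdiff p d) ≡ ℤ.+ Σℕ N (δ< p d) ℤ.- ℤ.+ Σℕ N (δ∈ p d)
Σℤ-δdiff p d zero    = refl
Σℤ-δdiff p d (suc N) = begin
    Σℤ N (δdiff p d) ℤ.+ δdiff p d N
  ≡⟨ cong (ℤ._+ δdiff p d N) (Σℤ-δdiff p d N) ⟩
    (ℤ.+ A ℤ.- ℤ.+ B) ℤ.+ (ℤ.+ a ℤ.- ℤ.+ c)
  ≡⟨ regroup (ℤ.+ A) (ℤ.+ B) (ℤ.+ a) (ℤ.+ c) ⟩
    (ℤ.+ A ℤ.+ ℤ.+ a) ℤ.- (ℤ.+ B ℤ.+ ℤ.+ c)
  ≡⟨ sym (cong₂ ℤ._-_ (ℤP.pos-+ A a) (ℤP.pos-+ B c)) ⟩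
    ℤ.+ (A + a) ℤ.- ℤ.+ (B + c)
  ∎
  where
  open ≡-Reasoning
  A = Σℕ N (δ< p d)
  B = Σℕ N (δ∈ p d)
  a = δ< p d N
  c = δ∈ p d N
  regroup : ∀ (A B a c : ℤ) → (A ℤ.- B) ℤ.+ (a ℤ.- c) ≡ (A ℤ.+ a) ℤ.- (B ℤ.+ c)
  regroup = ℤ-solve-∀

ℤ-difference : ∀ b l {A₁ B₁ A₂ B₂} L → b * A₁ + l * A₂ ≤ L + (b * B₁ + l * B₂) →
  ℤ.+ b ℤ.* (ℤ.+ A₁ ℤ.- ℤ.+ B₁) ℤ.+ ℤ.+ l ℤ.* (ℤ.+ A₂ ℤ.- ℤ.+ B₂) ℤ.≤ ℤ.+ L
ℤ-difference b l {A₁} {B₁} {A₂} {B₂} L X≤L+Y = begin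
    ℤ.+ b ℤ.* (ℤ.+ A₁ ℤ.- ℤ.+ B₁) ℤ.+ ℤ.+ l ℤ.* (ℤ.+ A₂ ℤ.- ℤ.+ B₂)
  ≡⟨ regroup (ℤ.+ b) (ℤ.+ l) (ℤ.+ A₁) (ℤ.+ B₁) (ℤ.+ A₂) (ℤ.+ B₂) ⟩
    (ℤ.+ b ℤ.* ℤ.+ A₁ ℤ.+ ℤ.+ l ℤ.* ℤ.+ A₂) ℤ.- (ℤ.+ b ℤ.* ℤ.+ B₁ ℤ.+ ℤ.+ l ℤ.* ℤ.+ B₂)
  ≡⟨ sym (cong₂ ℤ._-_ (cast A₁ A₂) (cast B₁ B₂)) ⟩
    ℤ.+ (b * A₁ + l * A₂) ℤ.- ℤ.+ Y
  ≤⟨ ℤP.+-monoˡ-≤ (ℤ.- ℤ.+ Y) (ℤ.+≤+ X≤L+Y) ⟩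
    ℤ.+ (L + Y) ℤ.- ℤ.+ Y
  ≡⟨ cong (ℤ._- ℤ.+ Y) (ℤP.pos-+ L Y) ⟩
    (ℤ.+ L ℤ.+ ℤ.+ Y) ℤ.- ℤ.+ Y
  ≡⟨ cancel (ℤ.+ L) (ℤ.+ Y) ⟩
    ℤ.+ L
  ∎
  where
  open ℤP.≤-Reasoning
  Y = b * B₁ + l * B₂
  cast : ∀ x y → ℤ.+ (b * x + l * y) ≡ ℤ.+ b ℤ.* ℤ.+ x ℤ.+ ℤ.+ l ℤ.* ℤ.+ y
  cast x y = trans (ℤP.pos-+ (b * x) (l * y)) (cong₂ ℤ._+_ (ℤP.pos-* b x) (ℤP.pos-* l y))
  regroup : ∀ (b l A₁ B₁ A₂ B₂ : ℤ) →
    b ℤ.* (A₁ ℤ.- B₁) ℤ.+ l ℤ.* (A₂ ℤ.- B₂) ≡ (b ℤ.* A₁ ℤ.+ l ℤ.* A₂) ℤ.- (b ℤ.* B₁ ℤ.+ l ℤ.* B₂)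
  regroup = ℤ-solve-∀
  cancel : ∀ (L Y : ℤ) → (L ℤ.+ Y) ℤ.- Y ≡ L
  cancel = ℤ-solve-∀

-- For m = n + 1, key-inequality with the residue machinery for
-- p, d (p acts injectively modulo d since p is a prime exceeding d) gives the
-- statement once the integer sums are written as differences of natural sums.
mainTheorem8 : (p d b m l : ℕ) → .{{_ : NonZero d}} → Prime p → d ≥ 1 → b ≥ 1
    → 3 * d < p → m ≥ 1 → l ≤ b
    → (is : Fin l → Fin b) → Injective _≡_ _≡_ is
    → (τ : AIdx m b l ↔ AIdx m b l)
    → ℤ.+ (ΣA m b l (δτ< p d m b l is (Inverse.to τ)))
    ℤ.≥ (ℤ.+ b) ℤ.* Σℤ m (δdiff p d) ℤ.+ (ℤ.+ l) ℤ.* δdiff p d m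
mainTheorem8 p d b (suc n) l p-prime _ _ 3d<p _ l≤b is _ τ =
  subst (ℤ._≤ ℤ.+ L) (cong (λ s → ℤ.+ b ℤ.* s ℤ.+ ℤ.+ l ℤ.* δdiff p d (suc n)) (sym (Σℤ-δdiff p d (suc n))))
    (ℤ-difference b l L (key-inequality n b l is τ l≤b))
  where
  d<p : d < p
  d<p = ≤-<-trans (m≤m+n d (2 * d)) 3d<p
  open Residues p d (prime⇒mul-injective p-prime d<p)
  L = ΣA (suc n) b l (δτ< p d (suc n) b l is (Inverse.to τ))
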